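{- An inversion sequence is pop stack sortable if and only if it avoids each of the patterns $120$, $201$, and $1010$.
   Context: An inversion sequence of length $n$ is a word $e=e_1\cdots e_n$ of integers with $0\le e_i\le i-1$ for each $i$. A word $w=w_1\cdots w_n$ contains a pattern $p=p_1\cdots p_k$ if there are indices $1\le \alpha_1<\cdots<\alpha_k\le n$ such that for all $i,j$: $w_{\alpha_i}<w_{\alpha_j}$ iff $p_i<p_j$, and $w_{\alpha_i}=w_{\alpha_j}$ iff $p_i=p_j$; otherwise $w$ avoids $p$. A pop stack is a stack (entries read left to right; a push moves the next input entry onto the top of the stack) in which every pop operation empties the whole stack, moving all its entries to the end of the output, from top to bottom. A word is pop stack sortable if some sequence of pushes and pops outputs all its entries in weakly increasing order. -}

module Defs where

open import Data.Nat using (ℕ; _≤_; _<_)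
open import Data.Fin using (Fin; toℕ) renaming (_<_ to _<ᶠ_)
open import Data.Vec using (Vec; lookup; toList; []; _∷_)
open import Data.List using (List; []; _∷_; _++_)
open import Data.List.Relation.Unary.Linked using (Linked)
open import Data.Product using (Σ; ∃; _×_)
open import Relation.Binary.PropositionalEquality using (_≡_)
open import Relation.Binary.Construct.Closure.ReflexiveTransitive using (Star)
open import Relation.Nullary using (¬_)
open import Function.Bundles using (_⇔_)

-- Inversion sequence of length n, 0-indexed positions: e_i ≤ i
-- (equivalently, 1-indexed: 0 ≤ e_i ≤ i - 1).
IsInversionSeq : ∀ {n} → Vec ℕ n → Set
IsInversionSeq {n} e = (i : Fin n) → lookup e i ≤ toℕ i

Contains : ∀ {n k} → Vec ℕ n → Vec ℕ k → Set
Contains {n} {k} w p =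
  Σ (Fin k → Fin n) λ α →
    (∀ i j → i <ᶠ j → α i <ᶠ α j) ×
    (∀ i j → (lookup w (α i) < lookup w (α j)) ⇔ (lookup p i < lookup p j)) ×
    (∀ i j → (lookup w (α i) ≡ lookup w (α j)) ⇔ (lookup p i ≡ lookup p j))

Avoids : ∀ {n k} → Vec ℕ n → Vec ℕ k → Set
Avoids w p = ¬ Contains w p

-- Pop stack configuration: (remaining input, stack with top at head, output so far).
record Config : Set where
  constructor ⟨_,_,_⟩
  field
    input  : List ℕ
    stack  : List ℕ
    output : List ℕ

data PopStep : Config → Config → Set where
  push : ∀ {x inp st out} → PopStep ⟨ x ∷ inp , st , out ⟩ ⟨ inp , x ∷ st , out ⟩
  pop  : ∀ {inp st out} → PopStep ⟨ inp , st , out ⟩ ⟨ inp , [] , out ++ st ⟩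

PopStackSortable : ∀ {n} → Vec ℕ n → Set
PopStackSortable w =
  ∃ λ out → Star PopStep ⟨ toList w , [] , [] ⟩ ⟨ [] , [] , out ⟩ × Linked _≤_ out

pat120 : Vec ℕ 3
pat120 = 1 ∷ 2 ∷ 0 ∷ []

pat201 : Vec ℕ 3
pat201 = 2 ∷ 0 ∷ 1 ∷ []

pat1010 : Vec ℕ 4
pat1010 = 1 ∷ 0 ∷ 1 ∷ 0 ∷ []

{-# OPTIONS --safe #-}

-- The first entry of each of 120, 201 and 1010 exceeds the last one, so a sorting run must
-- keep it on the stack until the last entry is read; meanwhile some entry is pushed onto a
-- smaller one, and popping outputs the two in the wrong order. A run restricts to any
-- subsequence of its input, so a sortable word avoids the three patterns.
-- Conversely, let the run push while the next entry is at most the top of the stack and pop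
-- otherwise. When it pops a stack with bottom m and top t because the next entry y exceeds t,
-- no unread entry z is below m, for otherwise m, t, y and z would contain one of the patterns.
-- Hence every popped block is sorted and bounded by all later output.
module Submission where

open import Defs
open import Data.Empty using (⊥; ⊥-elim)
open import Data.Fin as Fin using (Fin; zero; suc; #_) renaming (_<_ to _<ᶠ_)
open import Data.List using (List; []; _∷_; _++_; map; length; tabulate)
open import Data.List.Properties using (++-identityʳ; ++-assoc; map-∘)
open import Data.List.Membership.Propositional using (_∈_)
open import Data.List.Membership.Propositional.Properties using (∈-++⁺ˡ; ∈-++⁺ʳ)
open import Data.List.Relation.Unary.Any using (here; there)
open import Data.List.Relation.Unary.All as All using (All; []; _∷_)
open import Data.List.Relation.Unary.AllPairs as AllPairs using (AllPairs; []; _∷_)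
open import Data.List.Relation.Unary.AllPairs.Properties using (tabulate⁺-<) renaming (map⁻ to AllPairs-map⁻)
open import Data.List.Relation.Unary.Linked as Linked using (Linked; []; [-]; _∷_)
open import Data.List.Relation.Unary.Linked.Properties using (Linked⇒AllPairs; AllPairs⇒Linked)
open import Data.List.Relation.Binary.Sublist.Propositional using (_⊆_; _⊈_; []; _∷_; _∷ʳ_; ⊆-refl; ⊆-trans; minimum; from∈)
open import Data.List.Relation.Binary.Sublist.Propositional.Properties using (All-resp-⊆; ∷ˡ⁻; ++⁺; ++⁺ʳ)
open import Data.Nat using (ℕ; zero; suc; _≤_; _<_; _≤?_; z≤n; z<s; s<s; s<s⁻¹)
open import Data.Nat.Properties using (≤-refl; ≤-trans; <-trans; <-irrefl; <-asym; <⇒≱; ≰⇒>; ≮⇒≥; <-cmp)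
open import Data.Product using (Σ; ∃; _×_; _,_; proj₁; proj₂)
open import Data.Sum using (_⊎_; inj₁; inj₂)
open import Data.Vec as Vec using (Vec; []; _∷_; lookup; toList)
open import Data.Vec.Properties using (lookup-map)
open import Data.Vec.Relation.Unary.All as VecAll using ([]; _∷_)
open import Data.Vec.Relation.Unary.All.Properties using (lookup⁺)
open import Function using (_∘_)
open import Function.Bundles using (_⇔_; mk⇔; Equivalence)
open import Function.Properties.Equivalence using () renaming (trans to ⇔-trans)
open import Relation.Binary.Definitions using (tri<; tri≈; tri>)
open import Relation.Binary.PropositionalEquality using (_≡_; refl; sym; trans; cong; subst; subst₂)
open import Relation.Binary.Construct.Closure.ReflexiveTransitive using (Star; ε; _◅_)
open import Relation.Nullary using (¬_; yes; no)

AllPairs-resp-⊆ : ∀ {A : Set} {R : A → A → Set} {xs ys : List A} → xs ⊆ ys → AllPairs R ys → AllPairs R xs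
AllPairs-resp-⊆ []         []         = []
AllPairs-resp-⊆ (_ ∷ʳ τ)   (_ ∷ rys)  = AllPairs-resp-⊆ τ rys
AllPairs-resp-⊆ (refl ∷ τ) (ry ∷ rys) = All-resp-⊆ τ ry ∷ AllPairs-resp-⊆ τ rys

AllPairs-⊆-pair : ∀ {A : Set} {R : A → A → Set} {x y : A} {xs : List A} → AllPairs R xs → x ∷ y ∷ [] ⊆ xs → R x y
AllPairs-⊆-pair rxs τ with AllPairs-resp-⊆ τ rxs
... | (rxy ∷ []) ∷ _ = rxy

linked-++ : ∀ {m xs ys} → Linked _≤_ xs → All (_≤ m) xs → Linked _≤_ (m ∷ ys) → Linked _≤_ (xs ++ ys)
linked-++ []          []         m≤ys       = Linked.tail m≤ys
linked-++ [-]         (_ ∷ [])   [-]        = [-]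
linked-++ [-]         (x≤m ∷ []) (m≤y ∷ ys) = ≤-trans x≤m m≤y ∷ ys
linked-++ (x≤x′ ∷ xs) (_ ∷ ≤m)   m≤ys       = x≤x′ ∷ linked-++ xs ≤m m≤ys

StrictlyIncreasing : ∀ {k n} → (Fin k → Fin n) → Set
StrictlyIncreasing α = ∀ i j → i <ᶠ j → α i <ᶠ α j

lift-increasing : ∀ {k n} {α : Fin k → Fin n} → StrictlyIncreasing α → StrictlyIncreasing (Fin.lift 1 α)
lift-increasing inc zero    (suc j) _   = z<s
lift-increasing inc (suc i) (suc j) i<j = s<s (inc i j (s<s⁻¹ i<j))

⊆⇒embedding : ∀ {A : Set} {k n} (v : Vec A k) (w : Vec A n) → toList v ⊆ toList w →
              Σ (Fin k → Fin n) λ α → StrictlyIncreasing α × (∀ i → lookup w (α i) ≡ lookup v i)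
⊆⇒embedding []      _       _          = (λ ()) , (λ ()) , (λ ())
⊆⇒embedding (x ∷ v) (y ∷ w) (_ ∷ʳ τ)   =
  let α , inc , at = ⊆⇒embedding (x ∷ v) w τ in
  suc ∘ α , (λ i j i<j → s<s (inc i j i<j)) , at
⊆⇒embedding (x ∷ v) (y ∷ w) (refl ∷ τ) =
  let α , inc , at = ⊆⇒embedding v w τ in
  Fin.lift 1 α , lift-increasing inc , λ { zero → refl ; (suc i) → at i }

positive⇒map-suc : ∀ {n} {is : List (Fin (suc n))} → All (Fin.zero {n} <ᶠ_) is → ∃ λ js → is ≡ map suc js
positive⇒map-suc []                        = [] , refl
positive⇒map-suc {is = suc j ∷ _} (_ ∷ pos) =
  let js , eq = positive⇒map-suc pos in j ∷ js , cong (suc j ∷_) eq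

map-lookup-⊆ : ∀ {A : Set} {n} (w : Vec A n) {is : List (Fin n)} → AllPairs _<ᶠ_ is → map (lookup w) is ⊆ toList w
map-lookup-∷-⊆ : ∀ {A : Set} {n} {x : A} (w : Vec A n) {is : List (Fin (suc n))} →
                 All (Fin.zero {n} <ᶠ_) is → AllPairs _<ᶠ_ is → map (lookup (x ∷ w)) is ⊆ toList w

map-lookup-⊆ _       {[]}        _              = minimum _
map-lookup-⊆ (x ∷ w) {zero ∷ _}  (0<is ∷ inc)   = refl ∷ map-lookup-∷-⊆ w 0<is inc
map-lookup-⊆ (x ∷ w) {suc _ ∷ _} inc@(i<is ∷ _) = x ∷ʳ map-lookup-∷-⊆ w (z<s ∷ All.map (<-trans z<s) i<is) inc

map-lookup-∷-⊆ w pos inc with positive⇒map-suc pos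
... | js , refl = subst (_⊆ toList w) (map-∘ js) (map-lookup-⊆ w (AllPairs.map s<s⁻¹ (AllPairs-map⁻ inc)))

_!_ : List ℕ → ℕ → ℕ
[]       ! _     = 0
(v ∷ _)  ! zero  = v
(_ ∷ vs) ! suc i = vs ! i

!-increasing : ∀ {vs x y} → Linked _<_ vs → x < y → y < length vs → vs ! x < vs ! y
!-increasing          {x = zero}  {suc zero}    (v<v′ ∷ _)     _   _  = v<v′
!-increasing          {x = zero}  {suc (suc y)} (v<v′ ∷ chain) _   y< = <-trans v<v′ (!-increasing chain z<s (s<s⁻¹ y<))
!-increasing {_ ∷ []} {x = zero}  {suc _}       _              _   (s<s ())
!-increasing {_ ∷ _}  {x = suc x} {suc y}       chain          x<y y< = !-increasing (Linked.tail chain) (s<s⁻¹ x<y) (s<s⁻¹ y<)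

strictMono⇒orderIso : ∀ {f : ℕ → ℕ} {x y} → (x < y → f x < f y) → (y < x → f y < f x) →
                      (f x < f y ⇔ x < y) × (f x ≡ f y ⇔ x ≡ y)
strictMono⇒orderIso {f} {x} {y} mono< mono> = mk⇔ reflect< mono< , mk⇔ reflect≡ (cong f)
  where
  reflect< : f x < f y → x < y
  reflect< fx<fy with <-cmp x y
  ... | tri< x<y _ _  = x<y
  ... | tri≈ _ refl _ = ⊥-elim (<-irrefl refl fx<fy)
  ... | tri> _ _ y<x  = ⊥-elim (<-asym fx<fy (mono> y<x))
  reflect≡ : f x ≡ f y → x ≡ y
  reflect≡ fx≡fy with <-cmp x y
  ... | tri< x<y _ _ = ⊥-elim (<-irrefl fx≡fy (mono< x<y))
  ... | tri≈ _ x≡y _ = x≡y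
  ... | tri> _ _ y<x = ⊥-elim (<-irrefl (sym fx≡fy) (mono> y<x))

subsequence⇒contains : ∀ {n k} (w : Vec ℕ n) (p : Vec ℕ k) (vs : List ℕ) → Linked _<_ vs →
                       VecAll.All (_< length vs) p → toList (Vec.map (vs !_) p) ⊆ toList w → Contains w p
subsequence⇒contains w p vs chain bounded τ with ⊆⇒embedding (Vec.map (vs !_) p) w τ
... | α , inc , at = α , inc , (λ i j → proj₁ (iso i j)) , (λ i j → proj₂ (iso i j))
  where
  value : ∀ i → lookup w (α i) ≡ vs ! lookup p i
  value i = trans (at i) (lookup-map i (vs !_) p)
  mono : ∀ i j → lookup p i < lookup p j → vs ! lookup p i < vs ! lookup p j
  mono i j lt = !-increasing chain lt (lookup⁺ bounded j)
  iso : ∀ i j → (lookup w (α i) < lookup w (α j) ⇔ lookup p i < lookup p j)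
              × (lookup w (α i) ≡ lookup w (α j) ⇔ lookup p i ≡ lookup p j)
  iso i j rewrite value i | value j = strictMono⇒orderIso {vs !_} (mono i j) (mono j i)

-- Emits inp st res: from input inp and stack st, some run of the pop stack empties both
-- while appending res to the output.
data Emits : List ℕ → List ℕ → List ℕ → Set where
  halt : Emits [] [] []
  pop  : ∀ {inp st res} → Emits inp [] res → Emits inp st (st ++ res)
  push : ∀ {x inp st res} → Emits inp (x ∷ st) res → Emits (x ∷ inp) st res

star⇒emits : ∀ {inp st out fin} → Star PopStep ⟨ inp , st , out ⟩ ⟨ [] , [] , fin ⟩ →
             ∃ λ res → fin ≡ out ++ res × Emits inp st res
star⇒emits {out = out} ε = [] , sym (++-identityʳ out) , halt
star⇒emits (push ◅ run) =
  let res , eq , e = star⇒emits run in res , eq , push e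
star⇒emits {st = st} {out} (pop ◅ run) =
  let res , eq , e = star⇒emits run in st ++ res , trans eq (++-assoc out st res) , pop e

emits⇒star : ∀ {inp st res} → Emits inp st res → ∀ out → Star PopStep ⟨ inp , st , out ⟩ ⟨ [] , [] , out ++ res ⟩
emits⇒star halt     out = pop ◅ ε
emits⇒star (push e) out = push ◅ emits⇒star e out
emits⇒star (pop {inp} {st} {res} e) out =
  pop ◅ subst (λ fin → Star PopStep ⟨ inp , [] , out ++ st ⟩ ⟨ [] , [] , fin ⟩)
              (++-assoc out st res) (emits⇒star e (out ++ st))

Sortable : List ℕ → Set
Sortable L = ∃ λ res → Emits L [] res × Linked _≤_ res

popStackSortable⇔sortable : ∀ {n} (w : Vec ℕ n) → PopStackSortable w ⇔ Sortable (toList w)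
popStackSortable⇔sortable w = mk⇔ to (λ (res , e , sorted) → res , emits⇒star e [] , sorted)
  where
  to : PopStackSortable w → Sortable (toList w)
  to (out , run , sorted) with star⇒emits run
  ... | res , refl , e = res , e , sorted

emits-restrict : ∀ {inp st res inp′ st′} → Emits inp st res → inp′ ⊆ inp → st′ ⊆ st →
                 ∃ λ res′ → Emits inp′ st′ res′ × res′ ⊆ res
emits-restrict halt [] [] = [] , halt , []
emits-restrict {st′ = st′} (pop e) τ σ =
  let res′ , e′ , ρ = emits-restrict e τ [] in st′ ++ res′ , pop e′ , ++⁺ σ ρ
emits-restrict (push e) (refl ∷ τ) σ =
  let res′ , e′ , ρ = emits-restrict e τ (refl ∷ σ) in res′ , push e′ , ρ
emits-restrict (push e) (_ ∷ʳ τ) σ = emits-restrict e τ (_ ∷ʳ σ)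

sortable-⊆ : ∀ {L L′} → L′ ⊆ L → Sortable L → Sortable L′
sortable-⊆ τ (_ , e , sorted) =
  let res′ , e′ , ρ = emits-restrict e τ [] in
  res′ , e′ , AllPairs⇒Linked (AllPairs-resp-⊆ ρ (Linked⇒AllPairs ≤-trans sorted))

stack-sorted : ∀ {R : ℕ → ℕ → Set} {inp st res} → Emits inp st res → AllPairs R res → AllPairs R st
stack-sorted halt     _    = []
stack-sorted (pop e)  rres = AllPairs-resp-⊆ (++⁺ʳ _ ⊆-refl) rres
stack-sorted (push e) rres = AllPairs.tail (stack-sorted e rres)

stack-emitted : ∀ {inp st res x} → Emits inp st res → x ∈ st → x ∈ res
stack-emitted halt     ()
stack-emitted (pop e)  x∈st = ∈-++⁺ˡ x∈st
stack-emitted (push e) x∈st = stack-emitted e (there x∈st)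

input-emitted : ∀ {inp st res x} → Emits inp st res → x ∈ inp → x ∈ res
input-emitted halt              ()
input-emitted (pop {st = st} e) x∈inp         = ∈-++⁺ʳ st (input-emitted e x∈inp)
input-emitted (push e)          (here refl)   = stack-emitted e (here refl)
input-emitted (push e)          (there x∈inp) = input-emitted e x∈inp

unsortable-120 : ∀ {a b c} → c < a → a < b → ¬ Sortable (a ∷ b ∷ c ∷ [])
unsortable-120 {a} {b} {c} c<a a<b (_ , run , sorted) = stuck run (Linked⇒AllPairs ≤-trans sorted)
  where
  stuck : ∀ {res} → Emits (a ∷ b ∷ c ∷ []) [] res → AllPairs _≤_ res → ⊥
  stuck (pop e)         s = stuck e s
  stuck (push (pop e))  s = <⇒≱ c<a (AllPairs-⊆-pair s (refl ∷ from∈ (input-emitted e (there (here refl)))))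
  stuck (push (push e)) s = <⇒≱ a<b (AllPairs-⊆-pair (stack-sorted e s) ⊆-refl)

unsortable-201 : ∀ {a b c} → b < c → c < a → ¬ Sortable (a ∷ b ∷ c ∷ [])
unsortable-201 {a} {b} {c} b<c c<a (_ , run , sorted) = stuck run (Linked⇒AllPairs ≤-trans sorted)
  where
  stuck : ∀ {res} → Emits (a ∷ b ∷ c ∷ []) [] res → AllPairs _≤_ res → ⊥
  stuck (pop e)                s = stuck e s
  stuck (push (pop e))         s = <⇒≱ c<a (AllPairs-⊆-pair s (refl ∷ from∈ (input-emitted e (there (here refl)))))
  stuck (push (push (pop e)))  s = <⇒≱ c<a (AllPairs-⊆-pair s (_ ∷ʳ refl ∷ from∈ (input-emitted e (here refl))))
  stuck (push (push (push e))) s = <⇒≱ b<c (AllPairs-⊆-pair (stack-sorted e s) (refl ∷ refl ∷ minimum _))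

unsortable-1010 : ∀ {a b} → b < a → ¬ Sortable (a ∷ b ∷ a ∷ b ∷ [])
unsortable-1010 {a} {b} b<a (_ , run , sorted) = stuck run (Linked⇒AllPairs ≤-trans sorted)
  where
  stuck : ∀ {res} → Emits (a ∷ b ∷ a ∷ b ∷ []) [] res → AllPairs _≤_ res → ⊥
  stuck (pop e)                s = stuck e s
  stuck (push (pop e))         s = <⇒≱ b<a (AllPairs-⊆-pair s (refl ∷ from∈ (input-emitted e (here refl))))
  stuck (push (push (pop e)))  s = <⇒≱ b<a (AllPairs-⊆-pair s (_ ∷ʳ refl ∷ from∈ (input-emitted e (there (here refl)))))
  stuck (push (push (push e))) s = <⇒≱ b<a (AllPairs-⊆-pair (stack-sorted e s) (refl ∷ refl ∷ minimum _))

record AvoidsPatterns (L : List ℕ) : Set where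
  field
    no120  : ∀ {a b c} → c < a → a < b → a ∷ b ∷ c ∷ [] ⊈ L
    no201  : ∀ {a b c} → b < c → c < a → a ∷ b ∷ c ∷ [] ⊈ L
    no1010 : ∀ {a b} → b < a → a ∷ b ∷ a ∷ b ∷ [] ⊈ L

sortable⇒avoidsPatterns : ∀ {L} → Sortable L → AvoidsPatterns L
sortable⇒avoidsPatterns s = record
  { no120  = λ c<a a<b τ → unsortable-120 c<a a<b (sortable-⊆ τ s)
  ; no201  = λ b<c c<a τ → unsortable-201 b<c c<a (sortable-⊆ τ s)
  ; no1010 = λ b<a τ → unsortable-1010 b<a (sortable-⊆ τ s)
  }

module Greedy {L : List ℕ} (avoids : AvoidsPatterns L) where
  open AvoidsPatterns avoids

  -- m is the bottom and t the top entry of the stack (the same entry when it holds only one).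
  InOrder : ℕ → ℕ → List ℕ → Set
  InOrder m t inp = (m ≡ t × t ∷ inp ⊆ L) ⊎ (m ∷ t ∷ inp ⊆ L)

  no-entry-below-bottom : ∀ {m t y z inp} → t < y → InOrder m t (y ∷ inp) → z ∈ y ∷ inp → ¬ z < m
  no-entry-below-bottom t<y (inj₁ (refl , τ)) (here refl) y<t = <-asym y<t t<y
  no-entry-below-bottom t<y (inj₁ (refl , τ)) (there z∈) z<t = no120 z<t t<y (⊆-trans (refl ∷ refl ∷ from∈ z∈) τ)
  no-entry-below-bottom t<y (inj₂ τ) (here refl) y<m = no201 t<y y<m (⊆-trans (refl ∷ refl ∷ refl ∷ minimum _) τ)
  no-entry-below-bottom {m} {t} {y} {z} t<y (inj₂ τ) (there z∈) z<m with <-cmp z t | <-cmp y m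
  ... | tri< z<t _ _  | _             = no120 z<t t<y (⊆-trans (_ ∷ʳ refl ∷ refl ∷ from∈ z∈) τ)
  ... | tri> _ _ t<z  | _             = no201 t<z z<m (⊆-trans (refl ∷ refl ∷ _ ∷ʳ from∈ z∈) τ)
  ... | tri≈ _ refl _ | tri< y<m _ _  = no201 t<y y<m (⊆-trans (refl ∷ refl ∷ refl ∷ minimum _) τ)
  ... | tri≈ _ refl _ | tri> _ _ m<y  = no120 z<m m<y (⊆-trans (refl ∷ _ ∷ʳ refl ∷ from∈ z∈) τ)
  ... | tri≈ _ refl _ | tri≈ _ refl _ = no1010 z<m (⊆-trans (refl ∷ refl ∷ refl ∷ from∈ z∈) τ)

  input-above-bottom : ∀ {m t y inp} → t < y → InOrder m t (y ∷ inp) → All (m ≤_) (y ∷ inp)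
  input-above-bottom t<y ord = All.tabulate (λ z∈ → ≮⇒≥ (no-entry-below-bottom t<y ord z∈))

  push-order : ∀ {m t y inp} → InOrder m t (y ∷ inp) → InOrder m y inp
  push-order (inj₁ (refl , τ)) = inj₂ τ
  push-order (inj₂ τ)          = inj₂ (⊆-trans (refl ∷ _ ∷ʳ ⊆-refl) τ)

  pop-order : ∀ {m t y inp} → InOrder m t (y ∷ inp) → InOrder y y inp
  pop-order (inj₁ (_ , τ)) = inj₁ (refl , ∷ˡ⁻ τ)
  pop-order (inj₂ τ)       = inj₁ (refl , ∷ˡ⁻ (∷ˡ⁻ τ))

  greedy : ∀ {lo m t st} inp → Linked _≤_ (lo ∷ t ∷ st) → All (_≤ m) (lo ∷ t ∷ st) → All (lo ≤_) inp →
           InOrder m t inp → ∃ λ res → Emits inp (t ∷ st) res × Linked _≤_ (lo ∷ res)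
  greedy [] chain ≤m _ _ = _ , pop halt , linked-++ chain ≤m [-]
  greedy {t = t} (y ∷ inp) chain ≤m@(lo≤m ∷ t∷st≤m@(t≤m ∷ _)) (lo≤y ∷ lo≤inp) ord with y ≤? t
  ... | yes y≤t =
    let res , run , sorted = greedy inp (lo≤y ∷ y≤t ∷ Linked.tail chain) (lo≤m ∷ ≤-trans y≤t t≤m ∷ t∷st≤m)
                                    lo≤inp (push-order ord)
    in res , push run , sorted
  ... | no y≰t with input-above-bottom (≰⇒> y≰t) ord
  ...   | m≤y ∷ m≤inp =
    let res , run , sorted = greedy inp (m≤y ∷ [-]) (m≤y ∷ ≤-refl ∷ []) m≤inp (pop-order ord)
    in _ , pop (push run) , linked-++ chain ≤m sorted

avoidsPatterns⇒sortable : ∀ {L} → AvoidsPatterns L → Sortable L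
avoidsPatterns⇒sortable {[]}      _      = [] , halt , []
avoidsPatterns⇒sortable {y ∷ inp} avoids =
  let res , run , sorted = greedy {lo = 0} inp (z≤n ∷ [-]) (z≤n ∷ ≤-refl ∷ []) (All.universal (λ _ → z≤n) inp)
                                  (inj₁ (refl , ⊆-refl))
  in res , push run , Linked.tail sorted
  where open Greedy avoids

sortable⇔avoidsPatterns : ∀ {L} → Sortable L ⇔ AvoidsPatterns L
sortable⇔avoidsPatterns = mk⇔ sortable⇒avoidsPatterns avoidsPatterns⇒sortable

avoidsPatterns⇔avoids : ∀ {n} (w : Vec ℕ n) →
                        AvoidsPatterns (toList w) ⇔ (Avoids w pat120 × Avoids w pat201 × Avoids w pat1010)
avoidsPatterns⇔avoids {n} w = mk⇔ to from
  where
  open Equivalence using () renaming (from to ⇐)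

  occurrence : ∀ {k} {α : Fin k → Fin n} → StrictlyIncreasing α → map (lookup w) (tabulate α) ⊆ toList w
  occurrence inc = map-lookup-⊆ w (tabulate⁺-< (inc _ _))

  to : AvoidsPatterns (toList w) → Avoids w pat120 × Avoids w pat201 × Avoids w pat1010
  to avoids = avoid120 , avoid201 , avoid1010
    where
    open AvoidsPatterns avoids
    avoid120 : Avoids w pat120
    avoid120 (α , inc , iso< , _) = no120 (⇐ (iso< (# 2) (# 0)) z<s) (⇐ (iso< (# 0) (# 1)) (s<s z<s)) (occurrence inc)
    avoid201 : Avoids w pat201
    avoid201 (α , inc , iso< , _) = no201 (⇐ (iso< (# 1) (# 2)) z<s) (⇐ (iso< (# 2) (# 0)) (s<s z<s)) (occurrence inc)
    avoid1010 : Avoids w pat1010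
    avoid1010 (α , inc , iso< , iso≡) =
      no1010 (⇐ (iso< (# 1) (# 0)) z<s)
        (subst₂ (λ x y → lookup w (α (# 0)) ∷ lookup w (α (# 1)) ∷ x ∷ y ∷ [] ⊆ toList w)
                (⇐ (iso≡ (# 2) (# 0)) refl) (⇐ (iso≡ (# 3) (# 1)) refl) (occurrence inc))

  from : Avoids w pat120 × Avoids w pat201 × Avoids w pat1010 → AvoidsPatterns (toList w)
  from (avoid120 , avoid201 , avoid1010) = record
    { no120  = λ {a} {b} {c} c<a a<b τ →
        avoid120 (subsequence⇒contains w pat120 (c ∷ a ∷ b ∷ []) (c<a ∷ a<b ∷ [-]) (s<s z<s ∷ s<s (s<s z<s) ∷ z<s ∷ []) τ)
    ; no201  = λ {a} {b} {c} b<c c<a τ →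
        avoid201 (subsequence⇒contains w pat201 (b ∷ c ∷ a ∷ []) (b<c ∷ c<a ∷ [-]) (s<s (s<s z<s) ∷ z<s ∷ s<s z<s ∷ []) τ)
    ; no1010 = λ {a} {b} b<a τ →
        avoid1010 (subsequence⇒contains w pat1010 (b ∷ a ∷ []) (b<a ∷ [-]) (s<s z<s ∷ z<s ∷ s<s z<s ∷ z<s ∷ []) τ)
    }

mainTheorem4 : (n : ℕ) (e : Vec ℕ n) → IsInversionSeq e →
    (PopStackSortable e ⇔ (Avoids e pat120 × Avoids e pat201 × Avoids e pat1010))
mainTheorem4 n e _ =
  ⇔-trans (popStackSortable⇔sortable e) (⇔-trans sortable⇔avoidsPatterns (avoidsPatterns⇔avoids e))
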